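{- Let $G$ be a finite, simple, undirected graph that is chordal and net-free. If $G$ has an efficient dominating set, then the square $G^2$ is chordal.
   Context: A graph is chordal if it contains no induced cycle $C_k$ with $k \ge 4$. For a graph $G=(V,E)$ and $v\in V$, $N[v]$ is the closed neighborhood of $v$. A set $D \subseteq V$ is an efficient dominating set (e.d.s.) of $G$ if $|D \cap N[v]| = 1$ for every $v \in V$. The square $G^2$ has vertex set $V$, and distinct $x,y$ are adjacent in $G^2$ iff their distance in $G$ is at most $2$. The net is the graph on six vertices consisting of a triangle $a,b,c$ together with three further vertices $a',b',c'$ such that $a'$ is adjacent only to $a$, $b'$ only to $b$, and $c'$ only to $c$. $G$ is net-free if it has no induced subgraph isomorphic to the net. -}

module Defs where

open import Data.Nat using (ℕ; zero; suc; _≤_)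
open import Data.Fin using (Fin; toℕ; #_)
open import Data.Fin.Subset using (Subset; _∈_)
open import Data.Product using (Σ; ∃; ∃-syntax; _×_; _,_)
open import Data.Sum using (_⊎_)
open import Data.Empty using (⊥)
open import Relation.Nullary using (¬_; Dec)
open import Relation.Binary.PropositionalEquality using (_≡_; _≢_)
open import Function.Bundles using (_⇔_)
open import Function.Definitions using (Injective)

record Graph (n : ℕ) : Set₁ where
  field
    Adj   : Fin n → Fin n → Set
    sym   : ∀ {x y} → Adj x y → Adj y x
    irrefl : ∀ {x} → ¬ Adj x x
    dec   : ∀ x y → Dec (Adj x y)
open Graph public

InducedCopy : {n m : ℕ} → (Fin n → Fin n → Set) → (Fin m → Fin m → Set) → Set
InducedCopy {n} {m} R H =
  Σ (Fin m → Fin n) λ f → Injective _≡_ _≡_ f × (∀ i j → R (f i) (f j) ⇔ H i j)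

CycSucc : (k : ℕ) → Fin k → Fin k → Set
CycSucc k i j = (suc (toℕ i) ≡ toℕ j) ⊎ (suc (toℕ i) ≡ k × toℕ j ≡ 0)

CycAdj : (k : ℕ) → Fin k → Fin k → Set
CycAdj k i j = CycSucc k i j ⊎ CycSucc k j i

Chordal : {n : ℕ} → (Fin n → Fin n → Set) → Set
Chordal R = ∀ k → 4 ≤ k → ¬ InducedCopy R (CycAdj k)

data NetEdge : Fin 6 → Fin 6 → Set where
  e01 : NetEdge (# 0) (# 1)
  e12 : NetEdge (# 1) (# 2)
  e02 : NetEdge (# 0) (# 2)
  e03 : NetEdge (# 0) (# 3)
  e14 : NetEdge (# 1) (# 4)
  e25 : NetEdge (# 2) (# 5)

NetAdj : Fin 6 → Fin 6 → Set
NetAdj i j = NetEdge i j ⊎ NetEdge j i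

NetFree : {n : ℕ} → (Fin n → Fin n → Set) → Set
NetFree R = ¬ InducedCopy R NetAdj

InClosedNbhd : {n : ℕ} → Graph n → Fin n → Fin n → Set
InClosedNbhd G v u = (u ≡ v) ⊎ Adj G v u

EfficientDominatingSet : {n : ℕ} → Graph n → Subset n → Set
EfficientDominatingSet {n} G D =
  ∀ v → ∃[ u ] ((u ∈ D × InClosedNbhd G v u)
               × (∀ w → w ∈ D → InClosedNbhd G v w → w ≡ u))

HasEDS : {n : ℕ} → Graph n → Set
HasEDS {n} G = ∃[ D ] EfficientDominatingSet G D

SquareAdj : {n : ℕ} → Graph n → Fin n → Fin n → Set
SquareAdj G x y = x ≢ y × (Adj G x y ⊎ ∃[ z ] (Adj G x z × Adj G z y))

module Submission where

-- Suppose G² had an induced cycle g 0, …, g (K - 1) with K ≥ 4: consecutive g's are at distance at most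
-- 2 in G, the others at distance at least 3. In a chordal graph two non-adjacent neighbours of a vertex c
-- are never joined by a walk avoiding N[c]; walking around the cycle this shows that consecutive g's are
-- not adjacent and that common neighbours of g j, g (j + 1) and of g (j + 1), g (j + 2) are adjacent.
-- Net-freeness and the efficient dominating set D then provide, near some position, a guard: a vertex of
-- D adjacent to g j, not to g (j + 1), and to all their common neighbours. Guards propagate all around
-- the cycle and yield distinct vertices of D attached to a closed walk of common neighbours in G; the
-- first chord of that walk gives either an induced net or an induced cycle of length at least 4.

open import Data.Nat using (ℕ; zero; suc; _+_; _*_; _≤_; _<_; z≤n; s≤s; _≤?_; _<?_; _%_; _/_; NonZero)
open import Data.Nat.Properties
open import Data.Nat.DivMod
open import Data.Nat.Induction using (<-rec)
open import Data.Nat.Tactic.RingSolver using (solve-∀)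
open import Data.Fin using (Fin; toℕ)
open import Data.Fin.Patterns
open import Data.Fin.Properties using (toℕ-injective; toℕ<n; toℕ-fromℕ<; any?) renaming (_≟_ to _≟ᶠ_)
open import Data.Fin.Subset using (Subset; _∈_)
open import Data.Product using (∃; ∃₂; _×_; _,_; proj₁; proj₂)
open import Data.Sum using (_⊎_; inj₁; inj₂; [_,_]′)
import Data.Sum as Sum
open import Data.Empty using (⊥; ⊥-elim)
open import Relation.Nullary using (¬_; Dec; yes; no)
open import Relation.Nullary.Decidable using (_×-dec_; _⊎-dec_; ¬?; decidable-stable)
open import Relation.Binary.PropositionalEquality
  using (_≡_; _≢_; refl; trans; cong; subst; subst₂; module ≡-Reasoning) renaming (sym to ≡-sym)
open import Relation.Binary.Definitions using (tri<; tri≈; tri>)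
open import Function.Bundles using (mk⇔; Equivalence)
open import Defs hiding (sym)

m<n⇒∃[o]n≡1+m+o : ∀ {s t} → s < t → ∃ λ o → t ≡ suc (s + o)
m<n⇒∃[o]n≡1+m+o s<t with o , eq ← m≤n⇒∃[o]m+o≡n s<t = o , ≡-sym eq

minimal : {P : ℕ → Set} → (∀ i → Dec (P i)) → ∀ N → P N →
          ∃ λ j → j ≤ N × P j × (∀ {t} → t < j → ¬ P t)
minimal {P} P? = <-rec Goal search
  where
  Goal : ℕ → Set
  Goal N = P N → ∃ λ j → j ≤ N × P j × (∀ {t} → t < j → ¬ P t)
  search : ∀ N → (∀ {M} → M < N → Goal M) → Goal N
  search N below pN with anyUpTo? P? N
  ... | no none = N , ≤-refl , pN , λ t<N pt → none (_ , t<N , pt)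
  ... | yes (t , t<N , pt) with j , j≤t , pj , least ← below t<N pt =
    j , ≤-trans j≤t (<⇒≤ t<N) , pj , least

gap-cases : ∀ {k i j} → i < j → j ≤ 3 + k →
  j ≡ suc i ⊎ (∃ λ d → j ≡ i + d × 2 ≤ d × d ≤ 2 + k) ⊎ (i ≡ 0 × j ≡ 3 + k)
gap-cases {k} {i} i<j j≤ with m<n⇒∃[o]n≡1+m+o i<j
... | zero , refl = inj₁ (cong suc (+-identityʳ i))
... | suc o , refl with suc (suc o) ≤? 2 + k
...   | yes d≤ = inj₂ (inj₁ (suc (suc o) , ≡-sym (+-suc i (suc o)) , s≤s (s≤s z≤n) , d≤))
...   | no d≰ = inj₂ (inj₂ (n≤0⇒n≡0 (+-cancelʳ-≤ (suc o) i 0 (≤-trans (≤-pred j≤) 2+k≤)) ,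
                            ≤-antisym j≤ (s≤s (≤-trans 2+k≤ (m≤n+m (suc o) i)))))
  where
  2+k≤ : 2 + k ≤ suc o
  2+k≤ = ≤-pred (≰⇒> d≰)

pairwise-≢ : ∀ {A : Set} {B} {f : ℕ → A} → (∀ {i j} → i < j → j ≤ B → f i ≢ f j) →
             ∀ {i j} → i ≤ B → j ≤ B → i ≢ j → f i ≢ f j
pairwise-≢ distinct {i} {j} i≤B j≤B i≢j with <-cmp i j
... | tri< i<j _ _ = distinct i<j j≤B
... | tri≈ _ i≡j _ = ⊥-elim (i≢j i≡j)
... | tri> _ _ j<i = λ eq → distinct j<i i≤B (≡-sym eq)

double : ℕ → ℕ
double zero = zero
double (suc t) = suc (suc (double t))

zigzag : {A : Set} → (ℕ → A) → (ℕ → A) → ℕ → A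
zigzag a b zero = a 0
zigzag a b (suc zero) = b 0
zigzag a b (suc (suc i)) = zigzag (λ t → a (suc t)) (λ t → b (suc t)) i

zigzag-double : {A : Set} (a b : ℕ → A) → ∀ t → zigzag a b (double t) ≡ a t
zigzag-double a b zero = refl
zigzag-double a b (suc t) = zigzag-double (λ t → a (suc t)) (λ t → b (suc t)) t

zigzag-suc-double : {A : Set} (a b : ℕ → A) → ∀ t → zigzag a b (suc (double t)) ≡ b t
zigzag-suc-double a b zero = refl
zigzag-suc-double a b (suc t) = zigzag-suc-double (λ t → a (suc t)) (λ t → b (suc t)) t

double-or-suc-double : ∀ i → (∃ λ t → i ≡ double t) ⊎ (∃ λ t → i ≡ suc (double t))
double-or-suc-double zero = inj₁ (0 , refl)
double-or-suc-double (suc zero) = inj₂ (0 , refl)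
double-or-suc-double (suc (suc i)) =
  Sum.map (λ { (t , refl) → suc t , refl }) (λ { (t , refl) → suc t , refl }) (double-or-suc-double i)

double-<-cancel : ∀ {t s} → double t < double s → t < s
double-<-cancel {t} {zero} ()
double-<-cancel {zero} {suc s} _ = s≤s z≤n
double-<-cancel {suc t} {suc s} (s≤s (s≤s lt)) = s≤s (double-<-cancel lt)

suc-double-<-cancel : ∀ {t s} → suc (double t) < double s → t < s
suc-double-<-cancel {t} {zero} ()
suc-double-<-cancel {zero} {suc s} _ = s≤s z≤n
suc-double-<-cancel {suc t} {suc s} (s≤s (s≤s lt)) = s≤s (suc-double-<-cancel lt)

CycSuccℕ : ℕ → ℕ → ℕ → Set
CycSuccℕ L a b = (suc a ≡ b) ⊎ (suc a ≡ L × b ≡ 0)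

CycAdjℕ : ℕ → ℕ → ℕ → Set
CycAdjℕ L a b = CycSuccℕ L a b ⊎ CycSuccℕ L b a

[1+m]%n≡[1+m%n]%n : ∀ K i .{{_ : NonZero K}} → suc i % K ≡ suc (i % K) % K
[1+m]%n≡[1+m%n]%n K i = begin
  suc i % K                       ≡⟨ cong (λ x → suc x % K) (m≡m%n+[m/n]*n i K) ⟩
  (suc (i % K) + (i / K) * K) % K ≡⟨ [m+kn]%n≡m%n (suc (i % K)) (i / K) K ⟩
  suc (i % K) % K                 ∎
  where open ≡-Reasoning

%-CycSuccℕ : ∀ K i .{{_ : NonZero K}} → CycSuccℕ K (i % K) (suc i % K)
%-CycSuccℕ K i with suc (i % K) <? K
... | yes lt = inj₁ (≡-sym (trans ([1+m]%n≡[1+m%n]%n K i) (m<n⇒m%n≡m lt)))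
... | no nlt = inj₂ (wrap , trans ([1+m]%n≡[1+m%n]%n K i) (trans (cong (_% K) wrap) (n%n≡0 K)))
  where
  wrap : suc (i % K) ≡ K
  wrap = ≤-antisym (m%n<n i K) (≮⇒≥ nlt)

[m+n]%k≡[m%k+n]%k : ∀ K i {d} .{{_ : NonZero K}} → d < K → (i + d) % K ≡ (i % K + d) % K
[m+n]%k≡[m%k+n]%k K i {d} d<K = trans (%-distribˡ-+ i d K) (cong (λ x → (i % K + x) % K) (m<n⇒m%n≡m d<K))

[m+n]%k-cases : ∀ K {a d} .{{_ : NonZero K}} → a < K → d < K →
            (a + d) % K ≡ a + d ⊎ a + d ≡ (a + d) % K + K
[m+n]%k-cases K {a} {d} a<K d<K with a + d <? K
... | yes a+d<K = inj₁ (m<n⇒m%n≡m a+d<K)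
... | no a+d≮K with e , K+e≡a+d ← m≤n⇒∃[o]m+o≡n (≮⇒≥ a+d≮K) =
  inj₂ (trans (≡-sym K+e≡a+d) (trans (+-comm K e) (cong (_+ K) (≡-sym rem))))
  where
  open ≡-Reasoning
  e<K : e < K
  e<K = +-cancelˡ-< K e K (subst (_< K + K) (≡-sym K+e≡a+d) (+-mono-< a<K d<K))
  rem : (a + d) % K ≡ e
  rem = begin
    (a + d) % K ≡⟨ cong (_% K) (trans (≡-sym K+e≡a+d) (+-comm K e)) ⟩
    (e + K) % K ≡⟨ [m+n]%n≡m%n e K ⟩
    e % K       ≡⟨ m<n⇒m%n≡m e<K ⟩
    e           ∎

m≤n⇒m≢1+o+n : ∀ {d k} j → d ≤ k → d ≢ suc (j + k)
m≤n⇒m≢1+o+n {k = k} j d≤k refl = <-irrefl refl (≤-trans (s≤s (m≤n+m k j)) d≤k)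

-- The hypothesis on b says that b is the remainder of a + d modulo 4 + k.
ring-apart : ∀ {k a b d} → 2 ≤ d → d ≤ 2 + k → b ≡ a + d ⊎ a + d ≡ b + (4 + k) →
             a ≢ b × ¬ CycAdjℕ (4 + k) a b
ring-apart {d = suc zero} (s≤s ()) _ _
ring-apart {k} {a} {_} {suc (suc d)} _ d≤ (inj₁ refl) = (λ eq → m+1+n≢m a (≡-sym eq)) , not-adjacent
  where
  d≤k : d ≤ k
  d≤k = ≤-pred (≤-pred d≤)
  not-adjacent : ¬ CycAdjℕ (4 + k) a (a + suc (suc d))
  not-adjacent (inj₁ (inj₁ eq)) = m+1+n≢m a (≡-sym (suc-injective (trans eq (+-suc a (suc d)))))
  not-adjacent (inj₁ (inj₂ (_ , eq))) = m+1+n≢0 a eq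
  not-adjacent (inj₂ (inj₁ eq)) = m≢1+m+n a (≡-sym eq)
  not-adjacent (inj₂ (inj₂ (eq , refl))) = m≤n⇒m≢1+o+n 0 d≤k (suc-injective (suc-injective (suc-injective eq)))
ring-apart {k} {a} {b} {suc (suc d)} _ d≤ (inj₂ wrap) = distinct , not-adjacent
  where
  d≤k : d ≤ k
  d≤k = ≤-pred (≤-pred d≤)
  distinct : a ≢ b
  distinct refl = m≤n⇒m≢1+o+n 1 d≤k (suc-injective (suc-injective (+-cancelˡ-≡ a _ _ wrap)))
  not-adjacent : ¬ CycAdjℕ (4 + k) a b
  not-adjacent (inj₁ (inj₁ refl)) =
    m≤n⇒m≢1+o+n 2 d≤k (suc-injective (suc-injective (+-cancelˡ-≡ a _ _ (trans wrap (≡-sym (+-suc a (4 + k)))))))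
  not-adjacent (inj₁ (inj₂ (eq , refl))) =
    m+1+n≢0 0 (suc-injective (+-cancelˡ-≡ a _ _ (trans wrap (trans (≡-sym eq) (+-comm 1 a)))))
  not-adjacent (inj₂ (inj₁ refl)) =
    m≤n⇒m≢1+o+n 0 d≤k (suc-injective (suc-injective (suc-injective (+-cancelˡ-≡ b _ _ (trans (+-suc b (suc (suc d))) wrap)))))
  not-adjacent (inj₂ (inj₂ (_ , refl))) = m≤n⇒m≢1+o+n (suc b) d≤k (suc-injective (suc-injective (trans wrap (lemma b k))))
    where lemma : ∀ b k → b + (4 + k) ≡ suc (suc (suc (suc b + k)))
          lemma = solve-∀

module _ {n : ℕ} (G : Graph n) where

  infix 4 _~_ _~?_ _∈N[_] _∉N[_]

  _~_ : Fin n → Fin n → Set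
  _~_ = Adj G

  ~-sym : ∀ {x y} → x ~ y → y ~ x
  ~-sym = Graph.sym G

  _~?_ : ∀ x y → Dec (x ~ y)
  _~?_ = Graph.dec G

  ~⇒≢ : ∀ {x y} → x ~ y → x ≢ y
  ~⇒≢ x~x refl = Graph.irrefl G x~x

  _∈N[_] : Fin n → Fin n → Set
  u ∈N[ v ] = InClosedNbhd G v u

  _∉N[_] : Fin n → Fin n → Set
  u ∉N[ v ] = ¬ u ∈N[ v ]

  ∈N[]? : ∀ u v → Dec (u ∈N[ v ])
  ∈N[]? u v = (u ≟ᶠ v) ⊎-dec (v ~? u)

  ∈N[]-sym : ∀ {u v} → u ∈N[ v ] → v ∈N[ u ]
  ∈N[]-sym (inj₁ refl) = inj₁ refl
  ∈N[]-sym (inj₂ v~u) = inj₂ (~-sym v~u)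

  ∉N[]-sym : ∀ {u v} → u ∉N[ v ] → v ∉N[ u ]
  ∉N[]-sym u∉ v∈ = u∉ (∈N[]-sym v∈)

  ∉N[]-via : ∀ {v x y} → v ~ x → y ∉N[ v ] → ¬ y ~ x → x ∉N[ y ]
  ∉N[]-via {v} v~x y∉N[v] y≁x = [ (λ x≡y → y∉N[v] (inj₂ (subst (v ~_) x≡y v~x))) , y≁x ]′

  Far : Fin n → Fin n → Set
  Far x y = ∀ {z} → z ∈N[ x ] → z ∉N[ y ]

  Far-sym : ∀ {x y} → Far x y → Far y x
  Far-sym far z∈N[y] z∈N[x] = far z∈N[x] z∈N[y]

  ¬SquareAdj⇒Far : ∀ {x y} → x ≢ y → ¬ SquareAdj G x y → Far x y
  ¬SquareAdj⇒Far x≢y ¬sq (inj₁ refl) (inj₁ refl) = x≢y refl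
  ¬SquareAdj⇒Far x≢y ¬sq (inj₁ refl) (inj₂ y~z) = ¬sq (x≢y , inj₁ (~-sym y~z))
  ¬SquareAdj⇒Far x≢y ¬sq (inj₂ x~z) (inj₁ refl) = ¬sq (x≢y , inj₁ x~z)
  ¬SquareAdj⇒Far x≢y ¬sq (inj₂ x~z) (inj₂ y~z) = ¬sq (x≢y , inj₂ (_ , x~z , ~-sym y~z))

  inducedCopy : ∀ {k} {H : Fin k → Fin k → Set} (f : Fin k → Fin n) →
                (∀ {i j} → H i j → f i ~ f j) →
                (∀ i j → i ≡ j ⊎ H i j ⊎ f j ∉N[ f i ]) → InducedCopy _~_ H
  inducedCopy {H = H} f preserve classify = f , injective , λ i j → mk⇔ (reflect i j) preserve
    where
    injective : ∀ {i j} → f i ≡ f j → i ≡ j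
    injective {i} {j} fi≡fj with classify i j
    ... | inj₁ i≡j = i≡j
    ... | inj₂ (inj₁ h) = ⊥-elim (~⇒≢ (preserve h) fi≡fj)
    ... | inj₂ (inj₂ apart) = ⊥-elim (apart (inj₁ (≡-sym fi≡fj)))
    reflect : ∀ i j → f i ~ f j → H i j
    reflect i j fi~fj with classify i j
    ... | inj₁ refl = ⊥-elim (~⇒≢ fi~fj refl)
    ... | inj₂ (inj₁ h) = h
    ... | inj₂ (inj₂ apart) = ⊥-elim (apart (inj₂ fi~fj))

  record Net (a b c a′ b′ c′ : Fin n) : Set where
    field
      a~b : a ~ b
      b~c : b ~ c
      a~c : a ~ c
      a~a′ : a ~ a′
      b~b′ : b ~ b′
      c~c′ : c ~ c′
      b′∉N[a] : b′ ∉N[ a ]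
      c′∉N[a] : c′ ∉N[ a ]
      a′∉N[b] : a′ ∉N[ b ]
      c′∉N[b] : c′ ∉N[ b ]
      a′∉N[c] : a′ ∉N[ c ]
      b′∉N[c] : b′ ∉N[ c ]
      b′∉N[a′] : b′ ∉N[ a′ ]
      c′∉N[a′] : c′ ∉N[ a′ ]
      c′∉N[b′] : c′ ∉N[ b′ ]

  module NetEmbedding {a b c a′ b′ c′} (net : Net a b c a′ b′ c′) where
    open Net net

    f : Fin 6 → Fin n
    f 0F = a
    f 1F = b
    f 2F = c
    f 3F = a′
    f 4F = b′
    f 5F = c′

    edge : ∀ {i j} → NetEdge i j → f i ~ f j
    edge e01 = a~b
    edge e12 = b~c
    edge e02 = a~c
    edge e03 = a~a′
    edge e14 = b~b′
    edge e25 = c~c′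

    preserve : ∀ {i j} → NetAdj i j → f i ~ f j
    preserve (inj₁ e) = edge e
    preserve (inj₂ e) = ~-sym (edge e)

    Class : Fin 6 → Fin 6 → Set
    Class i j = i ≡ j ⊎ NetAdj i j ⊎ f j ∉N[ f i ]

    ↗ : ∀ {i j} → NetEdge i j → Class i j
    ↗ e = inj₂ (inj₁ (inj₁ e))

    ↙ : ∀ {i j} → NetEdge j i → Class i j
    ↙ e = inj₂ (inj₁ (inj₂ e))

    ⊘ : ∀ {i j} → f j ∉N[ f i ] → Class i j
    ⊘ apart = inj₂ (inj₂ apart)

    ⊘⁻ : ∀ {i j} → f i ∉N[ f j ] → Class i j
    ⊘⁻ apart = ⊘ (∉N[]-sym apart)

    classify : ∀ i j → Class i j
    classify 0F 0F = inj₁ refl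
    classify 0F 1F = ↗ e01
    classify 0F 2F = ↗ e02
    classify 0F 3F = ↗ e03
    classify 0F 4F = ⊘ b′∉N[a]
    classify 0F 5F = ⊘ c′∉N[a]
    classify 1F 0F = ↙ e01
    classify 1F 1F = inj₁ refl
    classify 1F 2F = ↗ e12
    classify 1F 3F = ⊘ a′∉N[b]
    classify 1F 4F = ↗ e14
    classify 1F 5F = ⊘ c′∉N[b]
    classify 2F 0F = ↙ e02
    classify 2F 1F = ↙ e12
    classify 2F 2F = inj₁ refl
    classify 2F 3F = ⊘ a′∉N[c]
    classify 2F 4F = ⊘ b′∉N[c]
    classify 2F 5F = ↗ e25
    classify 3F 0F = ↙ e03
    classify 3F 1F = ⊘⁻ a′∉N[b]
    classify 3F 2F = ⊘⁻ a′∉N[c]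
    classify 3F 3F = inj₁ refl
    classify 3F 4F = ⊘ b′∉N[a′]
    classify 3F 5F = ⊘ c′∉N[a′]
    classify 4F 0F = ⊘⁻ b′∉N[a]
    classify 4F 1F = ↙ e14
    classify 4F 2F = ⊘⁻ b′∉N[c]
    classify 4F 3F = ⊘⁻ b′∉N[a′]
    classify 4F 4F = inj₁ refl
    classify 4F 5F = ⊘ c′∉N[b′]
    classify 5F 0F = ⊘⁻ c′∉N[a]
    classify 5F 1F = ⊘⁻ c′∉N[b]
    classify 5F 2F = ↙ e25
    classify 5F 3F = ⊘⁻ c′∉N[a′]
    classify 5F 4F = ⊘⁻ c′∉N[b′]
    classify 5F 5F = inj₁ refl

  netFree⇒¬Net : NetFree _~_ → ∀ {a b c a′ b′ c′} → ¬ Net a b c a′ b′ c′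
  netFree⇒¬Net netFree net = netFree (inducedCopy f preserve classify)
    where open NetEmbedding net

  -- Walks avoiding a closed neighbourhood

  Avoids : (c u w x : Fin n) → Set
  Avoids c u w x = x ≡ u ⊎ x ≡ w ⊎ x ∉N[ c ]

  record AvoidingWalk (c u w : Fin n) (m : ℕ) (p : ℕ → Fin n) : Set where
    field
      start    : p 0 ≡ u
      end      : p m ≡ w
      step     : ∀ {i} → i < m → p (suc i) ∈N[ p i ]
      interior : ∀ {i} → 0 < i → i < m → Avoids c u w (p i)
  open AvoidingWalk

  -- skip i s p drops p (1 + i), …, p (1 + i + s).
  skip : ℕ → ℕ → (ℕ → Fin n) → ℕ → Fin n
  skip i s p t with t ≤? i
  ... | yes _ = p t
  ... | no _ = p (t + suc s)

  skip-≤ : ∀ {i s p t} → t ≤ i → skip i s p t ≡ p t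
  skip-≤ {i} {t = t} t≤i with t ≤? i
  ... | yes _ = refl
  ... | no t≰i = ⊥-elim (t≰i t≤i)

  skip-> : ∀ {i s p t} → i < t → skip i s p t ≡ p (t + suc s)
  skip-> {i} {t = t} i<t with t ≤? i
  ... | yes t≤i = ⊥-elim (<⇒≱ i<t t≤i)
  ... | no _ = refl

  skip-walk : ∀ {c u w p} i s ℓ → i < ℓ → AvoidingWalk c u w (ℓ + suc s) p →
              p (suc i + suc s) ∈N[ p i ] → AvoidingWalk c u w ℓ (skip i s p)
  skip-walk {c} {u} {w} {p} i s ℓ i<ℓ W junction = record
    { start = trans (skip-≤ {i} {s} {p} z≤n) (start W)
    ; end = trans (skip-> {i} {s} {p} i<ℓ) (end W)
    ; step = step′
    ; interior = interior′ }
    where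
    shifted : ∀ {t} → t < ℓ → t + suc s < ℓ + suc s
    shifted = +-monoˡ-< (suc s)
    below : ∀ {t} → t ≤ i → t < ℓ + suc s
    below t≤i = ≤-<-trans t≤i (<-≤-trans i<ℓ (m≤m+n ℓ (suc s)))
    step′ : ∀ {t} → t < ℓ → skip i s p (suc t) ∈N[ skip i s p t ]
    step′ {t} t<ℓ with ≤-<-connex (suc t) i | ≤-<-connex t i
    ... | inj₁ st≤i | _ = subst₂ _∈N[_] (≡-sym (skip-≤ st≤i)) (≡-sym (skip-≤ (<⇒≤ st≤i)))
                           (step W (below (<⇒≤ st≤i)))
    ... | inj₂ i<st | inj₁ t≤i with refl ← ≤-antisym t≤i (≤-pred i<st) =
      subst₂ _∈N[_] (≡-sym (skip-> (n<1+n t))) (≡-sym (skip-≤ t≤i)) junction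
    ... | inj₂ _ | inj₂ i<t = subst₂ _∈N[_] (≡-sym (skip-> (<-trans i<t (n<1+n t))))
                                (≡-sym (skip-> i<t)) (step W (shifted t<ℓ))
    interior′ : ∀ {t} → 0 < t → t < ℓ → Avoids c u w (skip i s p t)
    interior′ {t} 0<t t<ℓ with ≤-<-connex t i
    ... | inj₁ t≤i = subst (Avoids c u w) (≡-sym (skip-≤ t≤i)) (interior W 0<t (below t≤i))
    ... | inj₂ i<t = subst (Avoids c u w) (≡-sym (skip-> i<t))
                     (interior W (<-≤-trans 0<t (m≤m+n t (suc s))) (shifted t<ℓ))

  Chord : ℕ → (ℕ → Fin n) → ℕ → ℕ → Set
  Chord m p i j = suc i < j × j ≤ m × p j ∈N[ p i ]

  Stall : ℕ → (ℕ → Fin n) → ℕ → Set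
  Stall m p i = suc i ≤ m × p (suc i) ≡ p i

  chord? : ∀ m p → Dec (∃ λ i → i < m × ∃ λ j → j < suc m × Chord m p i j)
  chord? m p = anyUpTo? (λ i → anyUpTo? (λ j → (suc i <? j) ×-dec (j ≤? m) ×-dec ∈N[]? (p j) (p i)) (suc m)) m

  stall? : ∀ m p → Dec (∃ λ i → i < m × Stall m p i)
  stall? m p = anyUpTo? (λ i → (suc i ≤? m) ×-dec (p (suc i) ≟ᶠ p i)) m

  chord-shortens : ∀ {c u w m p i j} → AvoidingWalk c u w m p → Chord m p i j →
                   ∃ λ ℓ → ℓ < m × ∃ (AvoidingWalk c u w ℓ)
  chord-shortens {c} {u} {w} {m} {p} {i} {j} W (si<j , j≤m , pj∈N[pi])
    with s , refl ← m<n⇒∃[o]n≡1+m+o si<j | r , refl ← m≤n⇒∃[o]m+o≡n j≤m =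
    i + suc r , subst (i + suc r <_) (≡-sym (reorder i s r)) (m<m+n (i + suc r) (s≤s z≤n)) ,
    skip i s p , skip-walk i s (i + suc r) (m<m+n i (s≤s z≤n)) W′ junction
    where
    reorder : ∀ i s r → suc (suc i + s) + r ≡ i + suc r + suc s
    reorder = solve-∀
    W′ : AvoidingWalk c u w (i + suc r + suc s) p
    W′ = subst (λ ℓ → AvoidingWalk c u w ℓ p) (reorder i s r) W
    junction : p (suc i + suc s) ∈N[ p i ]
    junction = subst (λ x → p x ∈N[ p i ]) (≡-sym (cong suc (+-suc i s))) pj∈N[pi]

  stall⇒chord : ∀ {c u w m p i} → 2 ≤ m → AvoidingWalk c u w m p → Stall m p i →
                ∃₂ (Chord m p)
  stall⇒chord {m = m} {p} {i} 2≤m W (si≤m , stalled) with suc (suc i) ≤? m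
  ... | yes ssi≤m = i , suc (suc i) , ≤-refl , ssi≤m ,
                    subst (λ x → p (suc (suc i)) ∈N[ x ]) stalled (step W ssi≤m)
  ... | no ssi≰m = at-end i (≤-antisym si≤m (≤-pred (≰⇒> ssi≰m))) stalled
    where
    at-end : ∀ i → suc i ≡ m → p (suc i) ≡ p i → ∃₂ (Chord m p)
    at-end zero refl _ = ⊥-elim (<-irrefl refl 2≤m)
    at-end (suc i′) refl stalled′ = i′ , suc (suc i′) , ≤-refl , ≤-refl ,
      subst (_∈N[ p i′ ]) (≡-sym stalled′) (step W (s≤s (n≤1+n i′)))

  Chordless : ℕ → (ℕ → Fin n) → Set
  Chordless M p = (∀ {i j} → suc i < j → j ≤ M → p j ∉N[ p i ]) × (∀ {i} → suc i ≤ M → p (suc i) ≢ p i)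

  shorter-or-chordless : ∀ {c u w m p} → AvoidingWalk c u w (2 + m) p →
    (∃ λ ℓ → ℓ < 2 + m × ∃ (AvoidingWalk c u w ℓ)) ⊎ Chordless (2 + m) p
  shorter-or-chordless {m = m} {p} W with chord? (2 + m) p | stall? (2 + m) p
  ... | yes (_ , _ , _ , _ , chord) | _ = inj₁ (chord-shortens W chord)
  ... | no _ | yes (_ , _ , stall) with _ , _ , chord ← stall⇒chord (s≤s (s≤s z≤n)) W stall =
    inj₁ (chord-shortens W chord)
  ... | no noChord | no noStall = inj₂ (chord-free , stall-free)
    where
    chord-free : ∀ {i j} → suc i < j → j ≤ 2 + m → p j ∉N[ p i ]
    chord-free {i} {j} si<j j≤M pj∈ =
      noChord (i , <-≤-trans (<-trans (n<1+n i) si<j) j≤M , j , s≤s j≤M , si<j , j≤M , pj∈)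
    stall-free : ∀ {i} → suc i ≤ 2 + m → p (suc i) ≢ p i
    stall-free {i} si≤M eq = noStall (i , si≤M , si≤M , eq)

  inducedCycle : ∀ L (q : ℕ → Fin n) →
    (∀ {a b} → a < L → b < L → CycAdjℕ L a b → q a ~ q b) →
    (∀ {a b} → a < L → b < L → a ≡ b ⊎ CycAdjℕ L a b ⊎ q b ∉N[ q a ]) →
    InducedCopy _~_ (CycAdj L)
  inducedCycle L q preserve classify =
    inducedCopy (λ i → q (toℕ i)) (λ {i} {j} → preserve (toℕ<n i) (toℕ<n j))
      λ i j → [ (λ eq → inj₁ (toℕ-injective eq)) , inj₂ ]′ (classify (toℕ<n i) (toℕ<n j))

  module ChordlessWalk {c u w m p} (W : AvoidingWalk c u w (2 + m) p) (c~u : c ~ u) (c~w : c ~ w)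
                       (chordless : Chordless (2 + m) p) where

    M L : ℕ
    M = 2 + m
    L = 2 + M

    distinct : ∀ {s t} → s < t → t ≤ M → p t ≢ p s
    distinct s<t t≤M with m≤n⇒m<n∨m≡n s<t
    ... | inj₁ ss<t = λ eq → proj₁ chordless ss<t t≤M (inj₁ eq)
    ... | inj₂ refl = proj₂ chordless t≤M

    adjacent : ∀ {s} → suc s ≤ M → p s ~ p (suc s)
    adjacent ss≤M with step W ss≤M
    ... | inj₁ eq = ⊥-elim (proj₂ chordless ss≤M eq)
    ... | inj₂ ps~pss = ps~pss

    outside : ∀ {t} → 0 < t → t < M → p t ∉N[ c ]
    outside {t} 0<t t<M with interior W 0<t t<M
    ... | inj₁ pt≡u = ⊥-elim (distinct 0<t (<⇒≤ t<M) (trans pt≡u (≡-sym (start W))))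
    ... | inj₂ (inj₁ pt≡w) = ⊥-elim (distinct t<M ≤-refl (trans (end W) (≡-sym pt≡w)))
    ... | inj₂ (inj₂ pt∉N[c]) = pt∉N[c]

    q : ℕ → Fin n
    q zero = c
    q (suc t) = p t

    preserveSucc : ∀ {a b} → b < L → CycSuccℕ L a b → q a ~ q b
    preserveSucc {zero} _ (inj₁ refl) = subst (c ~_) (≡-sym (start W)) c~u
    preserveSucc {suc s} b<L (inj₁ refl) = adjacent (≤-pred (≤-pred b<L))
    preserveSucc {suc s} _ (inj₂ (refl , refl)) = ~-sym (subst (c ~_) (≡-sym (end W)) c~w)

    preserve : ∀ {a b} → a < L → b < L → CycAdjℕ L a b → q a ~ q b
    preserve _ b<L (inj₁ succ) = preserveSucc b<L succ
    preserve a<L _ (inj₂ succ) = ~-sym (preserveSucc a<L succ)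

    classify< : ∀ {a b} → a < b → b < L → CycAdjℕ L a b ⊎ q b ∉N[ q a ]
    classify< {zero} {suc zero} _ _ = inj₁ (inj₁ (inj₁ refl))
    classify< {zero} {suc (suc t)} _ b<L with m≤n⇒m<n∨m≡n (≤-pred (≤-pred b<L))
    ... | inj₁ t<M = inj₂ (outside (s≤s z≤n) t<M)
    ... | inj₂ refl = inj₁ (inj₂ (inj₂ (refl , refl)))
    classify< {suc s} {suc t} sa<sb b<L with m≤n⇒m<n∨m≡n sa<sb
    ... | inj₁ ss<st = inj₂ (proj₁ chordless (≤-pred ss<st) (≤-pred (≤-pred b<L)))
    ... | inj₂ refl = inj₁ (inj₁ (inj₁ refl))

    classify : ∀ {a b} → a < L → b < L → a ≡ b ⊎ CycAdjℕ L a b ⊎ q b ∉N[ q a ]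
    classify {a} {b} a<L b<L with <-cmp a b
    ... | tri< a<b _ _ = inj₂ (classify< a<b b<L)
    ... | tri≈ _ a≡b _ = inj₁ a≡b
    ... | tri> _ _ b<a = inj₂ (Sum.map swap ∉N[]-sym (classify< b<a a<L))
      where
      swap : ∀ {x y} → CycAdjℕ L x y → CycAdjℕ L y x
      swap = [ inj₂ , inj₁ ]′

    cycle : InducedCopy _~_ (CycAdj L)
    cycle = inducedCycle L q preserve classify

  -- If w ∉N[ u ], a shortest such walk, closed up through c, is an induced cycle of length at least 4.
  avoidingWalk⇒∈N[] : Chordal _~_ → ∀ {c u w m p} → c ~ u → c ~ w → AvoidingWalk c u w m p → w ∈N[ u ]
  avoidingWalk⇒∈N[] chordal {c} {u} {w} {m} c~u c~w = <-rec Goal go m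
    where
    Goal : ℕ → Set
    Goal m = ∀ {p} → AvoidingWalk c u w m p → w ∈N[ u ]
    go : ∀ m → (∀ {ℓ} → ℓ < m → Goal ℓ) → Goal m
    go zero _ W = inj₁ (trans (≡-sym (end W)) (start W))
    go (suc zero) _ W = subst₂ _∈N[_] (end W) (start W) (step W ≤-refl)
    go (suc (suc m)) shorter W with shorter-or-chordless W
    ... | inj₁ (_ , ℓ<m , _ , W′) = shorter ℓ<m W′
    ... | inj₂ chordless =
      ⊥-elim (chordal (4 + m) (s≤s (s≤s (s≤s (s≤s z≤n)))) (ChordlessWalk.cycle W c~u c~w chordless))

  zigzag-walk : ∀ {c u w} ℓ (a b : ℕ → Fin n) → a 0 ≡ u → a ℓ ≡ w →
    (∀ {t} → t < ℓ → b t ∈N[ a t ]) → (∀ {t} → t < ℓ → a (suc t) ∈N[ b t ]) →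
    (∀ {t} → 0 < t → t < ℓ → Avoids c u w (a t)) → (∀ {t} → t < ℓ → Avoids c u w (b t)) →
    AvoidingWalk c u w (double ℓ) (zigzag a b)
  zigzag-walk {c} {u} {w} ℓ a b a₀ aℓ b∈N[a] a∈N[b] a-avoids b-avoids = record
    { start = a₀
    ; end = trans (zigzag-double a b ℓ) aℓ
    ; step = step′
    ; interior = interior′ }
    where
    step′ : ∀ {i} → i < double ℓ → zigzag a b (suc i) ∈N[ zigzag a b i ]
    step′ {i} i<2ℓ with double-or-suc-double i
    ... | inj₁ (t , refl) = subst₂ _∈N[_] (≡-sym (zigzag-suc-double a b t)) (≡-sym (zigzag-double a b t))
                              (b∈N[a] (double-<-cancel i<2ℓ))
    ... | inj₂ (t , refl) = subst₂ _∈N[_] (≡-sym (zigzag-double a b (suc t))) (≡-sym (zigzag-suc-double a b t))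
                              (a∈N[b] (suc-double-<-cancel i<2ℓ))
    interior′ : ∀ {i} → 0 < i → i < double ℓ → Avoids c u w (zigzag a b i)
    interior′ {i} 0<i i<2ℓ with double-or-suc-double i
    ... | inj₁ (zero , refl) = ⊥-elim (<-irrefl refl 0<i)
    ... | inj₁ (suc t , refl) = subst (Avoids c u w) (≡-sym (zigzag-double a b (suc t)))
                                  (a-avoids (s≤s z≤n) (double-<-cancel i<2ℓ))
    ... | inj₂ (t , refl) = subst (Avoids c u w) (≡-sym (zigzag-suc-double a b t))
                              (b-avoids (suc-double-<-cancel i<2ℓ))

  -- Induced cycles of the square

  record SquareCycle (k : ℕ) (g : ℕ → Fin n) : Set where
    field
      periodic    : ∀ i → g (i + (4 + k)) ≡ g i
      consecutive : ∀ i → SquareAdj G (g i) (g (suc i))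
      far         : ∀ i {d} → 2 ≤ d → d ≤ 2 + k → Far (g i) (g (i + d))

  squareCycle : ∀ {k} → InducedCopy (SquareAdj G) (CycAdj (4 + k)) → ∃ (SquareCycle k)
  squareCycle {k} (f , f-injective , f-iff) =
    g , record { periodic = periodic ; consecutive = consecutive ; far = far }
    where
    K : ℕ
    K = 4 + k
    g : ℕ → Fin n
    g t = f (t mod K)
    toℕ-mod : ∀ t → toℕ (t mod K) ≡ t % K
    toℕ-mod t = toℕ-fromℕ< (m%n<n t K)
    periodic : ∀ i → g (i + K) ≡ g i
    periodic i = cong f (toℕ-injective (trans (toℕ-mod (i + K)) (trans ([m+n]%n≡m%n i K) (≡-sym (toℕ-mod i)))))
    consecutive : ∀ i → SquareAdj G (g i) (g (suc i))
    consecutive i = Equivalence.from (f-iff (i mod K) (suc i mod K))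
      (inj₁ (subst₂ (CycSuccℕ K) (≡-sym (toℕ-mod i)) (≡-sym (toℕ-mod (suc i))) (%-CycSuccℕ K i)))
    far : ∀ i {d} → 2 ≤ d → d ≤ 2 + k → Far (g i) (g (i + d))
    far i {d} 2≤d d≤ = ¬SquareAdj⇒Far
      (λ gi≡gj → proj₁ apart (trans (≡-sym (toℕ-mod i)) (trans (cong toℕ (f-injective gi≡gj)) (toℕ-mod (i + d)))))
      (λ sq → proj₂ apart (subst₂ (CycAdjℕ K) (toℕ-mod i) (toℕ-mod (i + d)) (Equivalence.to (f-iff _ _) sq)))
      where
      d<K : d < K
      d<K = m≤n⇒m≤1+n (s≤s d≤)
      apart : i % K ≢ (i + d) % K × ¬ CycAdjℕ K (i % K) ((i + d) % K)
      apart = ring-apart 2≤d d≤ (subst (λ b → b ≡ i % K + d ⊎ i % K + d ≡ b + K) (≡-sym ([m+n]%k≡[m%k+n]%k K i d<K))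
                                       ([m+n]%k-cases K (m%n<n i K) d<K))

  module _ {k : ℕ} {g : ℕ → Fin n} (C : SquareCycle k g) where
    open SquareCycle C

    shift : ∀ j → SquareCycle k (λ t → g (t + j))
    shift j = record
      { periodic = λ i → trans (cong g (+-rotate i j k)) (periodic (i + j))
      ; consecutive = λ i → consecutive (i + j)
      ; far = λ i {d} 2≤d d≤ → subst (λ x → Far (g (i + j)) (g x)) (+-swap i j d) (far (i + j) 2≤d d≤) }
      where
      +-rotate : ∀ i j k → i + (4 + k) + j ≡ i + j + (4 + k)
      +-rotate = solve-∀
      +-swap : ∀ i j d → i + j + d ≡ i + d + j
      +-swap = solve-∀

    link : ∀ i → ∃ λ z → z ∈N[ g i ] × z ∈N[ g (suc i) ]
    link i with consecutive i
    ... | _ , inj₁ gi~gsi = g (suc i) , inj₂ gi~gsi , inj₁ refl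
    ... | _ , inj₂ (z , gi~z , z~gsi) = z , inj₂ gi~z , inj₂ (~-sym z~gsi)

    far-0-2 : Far (g 0) (g 2)
    far-0-2 = far 0 (s≤s (s≤s z≤n)) (s≤s (s≤s z≤n))

    detour : Fin n → Fin n → ℕ → Fin n
    detour u w zero = u
    detour u w (suc t) with t <? 2 + k
    ... | yes _ = proj₁ (link (2 + t))
    ... | no _ = w

    detour-link : ∀ {u w t} → t < 2 + k → detour u w (suc t) ≡ proj₁ (link (2 + t))
    detour-link {t = t} t< with t <? 2 + k
    ... | yes _ = refl
    ... | no t≮ = ⊥-elim (t≮ t<)

    detour-end : ∀ {u w} → detour u w (3 + k) ≡ w
    detour-end with 2 + k <? 2 + k
    ... | yes k<k = ⊥-elim (<-irrefl refl k<k)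
    ... | no _ = refl

  module _ (chordal : Chordal _~_) {k : ℕ} {g : ℕ → Fin n} (C : SquareCycle k g) where
    open SquareCycle C

    -- u, g 2, link, g 3, …, link, g (4 + k) = g 0, w is a walk whose inner vertices are far from g 1.
    around : ∀ {u w} → g 1 ~ u → g 1 ~ w → u ∈N[ g 2 ] → w ∈N[ g 0 ] →
             Avoids (g 1) u w (g 2) → Avoids (g 1) u w (g 0) → w ∈N[ u ]
    around {u} {w} g1~u g1~w u∈N[g2] w∈N[g0] g2-avoids g0-avoids =
      avoidingWalk⇒∈N[] chordal g1~u g1~w
        (zigzag-walk (3 + k) (detour C u w) b refl (detour-end C {u}) b∈N[a] a∈N[b] a-avoids b-avoids)
      where
      b : ℕ → Fin n
      b t = g (2 + t)
      avoid-by-far : ∀ {d x} → 2 ≤ d → d ≤ 2 + k → x ∈N[ g (1 + d) ] → Avoids (g 1) u w x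
      avoid-by-far 2≤d d≤ x∈N = inj₂ (inj₂ λ x∈N[g1] → far 1 2≤d d≤ x∈N[g1] x∈N)
      b∈N[a] : ∀ {t} → t < 3 + k → b t ∈N[ detour C u w t ]
      b∈N[a] {zero} _ = ∈N[]-sym u∈N[g2]
      b∈N[a] {suc t} t< rewrite detour-link C {u} {w} (≤-pred t<) = ∈N[]-sym (proj₂ (proj₂ (link C (2 + t))))
      a∈N[b] : ∀ {t} → t < 3 + k → detour C u w (suc t) ∈N[ b t ]
      a∈N[b] {t} t< with m≤n⇒m<n∨m≡n (≤-pred t<)
      ... | inj₁ t<2+k rewrite detour-link C {u} {w} t<2+k = proj₁ (proj₂ (link C (2 + t)))
      ... | inj₂ refl rewrite detour-end C {u} {w} = subst (w ∈N[_]) (≡-sym (periodic 0)) w∈N[g0]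
      a-avoids : ∀ {t} → 0 < t → t < 3 + k → Avoids (g 1) u w (detour C u w t)
      a-avoids {suc zero} _ t< rewrite detour-link C {u} {w} (≤-pred t<) =
        avoid-by-far ≤-refl (s≤s (s≤s z≤n)) (proj₂ (proj₂ (link C 2)))
      a-avoids {suc (suc t)} _ t< rewrite detour-link C {u} {w} (≤-pred t<) =
        avoid-by-far (s≤s (s≤s z≤n)) (s≤s (s≤s (≤-pred (≤-pred (≤-pred t<))))) (proj₁ (proj₂ (link C (3 + t))))
      b-avoids : ∀ {t} → t < 3 + k → Avoids (g 1) u w (b t)
      b-avoids {zero} _ = g2-avoids
      b-avoids {suc t} t< with m≤n⇒m<n∨m≡n (≤-pred (≤-pred t<))
      ... | inj₁ t<1+k = avoid-by-far (s≤s (s≤s z≤n)) (s≤s (s≤s (≤-pred t<1+k))) (inj₁ refl)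
      ... | inj₂ refl = subst (Avoids (g 1) u w) (≡-sym (periodic 0)) g0-avoids

    towards-g2 : ∃ λ u → g 1 ~ u × u ∈N[ g 2 ] × (∀ {w} → Avoids (g 1) u w (g 2))
    towards-g2 with consecutive 1 | g 1 ~? g 2
    ... | _ | yes g1~g2 = g 2 , g1~g2 , inj₁ refl , inj₁ refl
    ... | _ , inj₁ g1~g2 | no g1≁g2 = ⊥-elim (g1≁g2 g1~g2)
    ... | g1≢g2 , inj₂ (z , g1~z , z~g2) | no g1≁g2 =
      z , g1~z , inj₂ (~-sym z~g2) , inj₂ (inj₂ [ (λ g2≡g1 → g1≢g2 (≡-sym g2≡g1)) , g1≁g2 ]′)

    consecutive-apart₀ : g 1 ∉N[ g 0 ]
    consecutive-apart₀ (inj₁ g1≡g0) = proj₁ (consecutive 0) (≡-sym g1≡g0)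
    consecutive-apart₀ (inj₂ g0~g1) with u , g1~u , u∈N[g2] , g2-avoids ← towards-g2 =
      far-0-2 C (∈N[]-sym (around g1~u (~-sym g0~g1) u∈N[g2] (inj₁ refl) g2-avoids (inj₂ (inj₁ refl))))
        u∈N[g2]

  module _ (chordal : Chordal _~_) {k : ℕ} {g : ℕ → Fin n} (C : SquareCycle k g) where

    consecutive-apart : ∀ j → g (suc j) ∉N[ g j ]
    consecutive-apart j = consecutive-apart₀ chordal (shift C j)

    links-adjacent₀ : ∀ {a b} → g 0 ~ a → g 1 ~ a → g 1 ~ b → g 2 ~ b → a ~ b
    links-adjacent₀ g0~a g1~a g1~b g2~b
      with around chordal C g1~b g1~a (inj₂ g2~b) (inj₂ g0~a)
             (inj₂ (inj₂ (consecutive-apart 1))) (inj₂ (inj₂ (∉N[]-sym (consecutive-apart 0))))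
    ... | inj₁ refl = ⊥-elim (far-0-2 C (inj₂ g0~a) (inj₂ g2~b))
    ... | inj₂ b~a = ~-sym b~a

    common-neighbour : ∀ j → ∃ λ a → g j ~ a × g (suc j) ~ a
    common-neighbour j with SquareCycle.consecutive C j
    ... | _ , inj₁ gj~gsj = ⊥-elim (consecutive-apart j (inj₂ gj~gsj))
    ... | _ , inj₂ (a , gj~a , a~gsj) = a , gj~a , ~-sym a~gsj

  record Corner (c₀ c₁ c₂ : Fin n) : Set where
    field
      c₁∉N[c₀] : c₁ ∉N[ c₀ ]
      c₂∉N[c₁] : c₂ ∉N[ c₁ ]
      far₀₂ : Far c₀ c₂
      link₀₁ : ∃ λ a → c₀ ~ a × c₁ ~ a
      link₁₂ : ∃ λ b → c₁ ~ b × c₂ ~ b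
      links-adjacent : ∀ {a b} → c₀ ~ a → c₁ ~ a → c₁ ~ b → c₂ ~ b → a ~ b
  open Corner

  Corner-reverse : ∀ {c₀ c₁ c₂} → Corner c₀ c₁ c₂ → Corner c₂ c₁ c₀
  Corner-reverse K = record
    { c₁∉N[c₀] = ∉N[]-sym (c₂∉N[c₁] K)
    ; c₂∉N[c₁] = ∉N[]-sym (c₁∉N[c₀] K)
    ; far₀₂ = Far-sym (far₀₂ K)
    ; link₀₁ = let b , c₁~b , c₂~b = link₁₂ K in b , c₂~b , c₁~b
    ; link₁₂ = let a , c₀~a , c₁~a = link₀₁ K in a , c₁~a , c₀~a
    ; links-adjacent = λ c₂~b c₁~b c₁~a c₀~a → ~-sym (links-adjacent K c₀~a c₁~a c₁~b c₂~b) }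

  module _ (chordal : Chordal _~_) {k : ℕ} {g : ℕ → Fin n} (C : SquareCycle k g) where

    corner₀ : Corner (g 0) (g 1) (g 2)
    corner₀ = record
      { c₁∉N[c₀] = consecutive-apart chordal C 0
      ; c₂∉N[c₁] = consecutive-apart chordal C 1
      ; far₀₂ = far-0-2 C
      ; link₀₁ = common-neighbour chordal C 0
      ; link₁₂ = common-neighbour chordal C 1
      ; links-adjacent = links-adjacent₀ chordal C }

  corner : Chordal _~_ → ∀ {k g} → SquareCycle k g → ∀ j → Corner (g j) (g (1 + j)) (g (2 + j))
  corner chordal C j = corner₀ chordal (shift C j)

  module _ (netFree : NetFree _~_) where

    -- If x ≁ b, the triangle c₁ a b with pendants x, c₀, c₂ is an induced net.
    pendant-adjacent : ∀ {c₀ c₁ c₂ x a b} → Corner c₀ c₁ c₂ → c₁ ~ x →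
      c₀ ~ a → c₁ ~ a → c₁ ~ b → c₂ ~ b → x ∉N[ c₀ ] → x ∉N[ c₂ ] → x ∉N[ a ] → x ~ b
    pendant-adjacent {c₀} {c₁} {c₂} {x} {a} {b} K c₁~x c₀~a c₁~a c₁~b c₂~b x∉N[c₀] x∉N[c₂] x∉N[a]
      with b ~? x
    ... | yes b~x = ~-sym b~x
    ... | no b≁x = ⊥-elim (netFree⇒¬Net netFree record
      { a~b = c₁~a ; b~c = links-adjacent K c₀~a c₁~a c₁~b c₂~b ; a~c = c₁~b
      ; a~a′ = c₁~x ; b~b′ = ~-sym c₀~a ; c~c′ = ~-sym c₂~b
      ; b′∉N[a] = ∉N[]-sym (c₁∉N[c₀] K)
      ; c′∉N[a] = c₂∉N[c₁] K
      ; a′∉N[b] = x∉N[a]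
      ; c′∉N[b] = λ c₂∈N[a] → far₀₂ K (inj₂ c₀~a) (∈N[]-sym c₂∈N[a])
      ; a′∉N[c] = [ (λ x≡b → x∉N[c₂] (inj₂ (subst (c₂ ~_) (≡-sym x≡b) c₂~b))) , b≁x ]′
      ; b′∉N[c] = λ c₀∈N[b] → far₀₂ K (∈N[]-sym c₀∈N[b]) (inj₂ c₂~b)
      ; b′∉N[a′] = ∉N[]-sym x∉N[c₀]
      ; c′∉N[a′] = ∉N[]-sym x∉N[c₂]
      ; c′∉N[b′] = λ c₂∈N[c₀] → far₀₂ K c₂∈N[c₀] (inj₁ refl) })

  -- Guards from the efficient dominating set

  module _ (chordal : Chordal _~_) (netFree : NetFree _~_) {D : Subset n}
           (eds : EfficientDominatingSet G D) where

    dominator : ∀ v → ∃ λ x → x ∈ D × x ∈N[ v ]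
    dominator v = let x , x∈D×x∈N[v] , _ = eds v in x , x∈D×x∈N[v]

    dominator-unique : ∀ {v x y} → x ∈ D → y ∈ D → x ∈N[ v ] → y ∈N[ v ] → x ≡ y
    dominator-unique {v} x∈D y∈D x∈N[v] y∈N[v] =
      let _ , _ , unique = eds v in trans (unique _ x∈D x∈N[v]) (≡-sym (unique _ y∈D y∈N[v]))

    record Guard (a b : Fin n) : Set where
      field
        vertex : Fin n
        dominating : vertex ∈ D
        adjacent : a ~ vertex
        not-adjacent : ¬ b ~ vertex
        covers : ∀ {m} → a ~ m → b ~ m → vertex ~ m
    open Guard

    -- The guard is the dominator of c₁.
    guard-from : ∀ {c₀ c₁ c₂ z} → Corner c₀ c₁ c₂ → z ∈ D → z ∉N[ c₁ ] →
                 (∀ {a} → c₀ ~ a → c₁ ~ a → z ∈N[ a ]) → Guard c₁ c₂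
    guard-from {c₀} {c₁} {c₂} {z} K z∈D z∉N[c₁] z-near
      with y , y∈D , y∈N[c₁] ← dominator c₁ | a₀ , c₀~a₀ , c₁~a₀ ← link₀₁ K = record
      { vertex = y ; dominating = y∈D ; adjacent = c₁~y ; not-adjacent = c₂≁y
      ; covers = λ c₁~m c₂~m →
          pendant-adjacent netFree K c₁~y c₀~a₀ c₁~a₀ c₁~m c₂~m y∉N[c₀] y∉N[c₂] (y-far c₀~a₀ c₁~a₀) }
      where
      y-far : ∀ {a} → c₀ ~ a → c₁ ~ a → y ∉N[ a ]
      y-far c₀~a c₁~a y∈N[a] =
        z∉N[c₁] (subst (_∈N[ c₁ ]) (dominator-unique y∈D z∈D y∈N[a] (z-near c₀~a c₁~a)) y∈N[c₁])
      c₁~y : c₁ ~ y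
      c₁~y = [ (λ y≡c₁ → ⊥-elim (y-far c₀~a₀ c₁~a₀ (subst (_∈N[ a₀ ]) (≡-sym y≡c₁) (inj₂ (~-sym c₁~a₀)))))
             , (λ c₁~y → c₁~y) ]′ y∈N[c₁]
      c₂≁y : ¬ c₂ ~ y
      c₂≁y c₂~y = y-far c₀~a₀ c₁~a₀ (inj₂ (links-adjacent K c₀~a₀ c₁~a₀ c₁~y c₂~y))
      y∉N[c₀] : y ∉N[ c₀ ]
      y∉N[c₀] = ∉N[]-via c₁~y (∉N[]-sym (c₁∉N[c₀] K)) (λ c₀~y → y-far c₀~y c₁~y (inj₁ refl))
      y∉N[c₂] : y ∉N[ c₂ ]
      y∉N[c₂] = ∉N[]-via c₁~y (c₂∉N[c₁] K) c₂≁y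

    guard-step : ∀ {c₀ c₁ c₂} → Corner c₀ c₁ c₂ → Guard c₀ c₁ → Guard c₁ c₂
    guard-step K γ = guard-from K (dominating γ)
      (∉N[]-via (adjacent γ) (c₁∉N[c₀] K) (not-adjacent γ))
      (λ c₀~a c₁~a → inj₂ (~-sym (covers γ c₀~a c₁~a)))

    guard-stepᵣ : ∀ {c₀ c₁ c₂} → Corner c₀ c₁ c₂ → Guard c₂ c₁ → Guard c₁ c₀
    guard-stepᵣ K = guard-step (Corner-reverse K)

    guard-nearby : ∀ {c₀ c₁ c₂ c₃ c₄} → Corner c₀ c₁ c₂ → Corner c₁ c₂ c₃ → Corner c₂ c₃ c₄ →
                   Guard c₁ c₂ ⊎ Guard c₂ c₃ ⊎ Guard c₃ c₄ ⊎ Guard c₁ c₀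
    guard-nearby {c₀} {c₁} {c₂} {c₃} K₀ K₁ K₂ with dominator c₁
    ... | x , x∈D , inj₁ x≡c₁ = inj₂ (inj₁ (guard-from K₁ x∈D
          (subst (_∉N[ c₂ ]) (≡-sym x≡c₁) (∉N[]-sym (c₂∉N[c₁] K₀)))
          (λ c₁~a _ → subst (_∈N[ _ ]) (≡-sym x≡c₁) (inj₂ (~-sym c₁~a)))))
    ... | x , x∈D , inj₂ c₁~x with c₂ ~? x | c₀ ~? x
    ...   | yes c₂~x | _ = inj₂ (inj₂ (inj₁ (guard-from K₂ x∈D (far₀₂ K₁ (inj₂ c₁~x))
            (λ c₂~a c₃~a → inj₂ (~-sym (links-adjacent K₁ c₁~x c₂~x c₂~a c₃~a))))))
    ...   | no _ | yes c₀~x = inj₂ (inj₁ (guard-from K₁ x∈D (far₀₂ K₀ (inj₂ c₀~x))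
            (λ c₁~a c₂~a → inj₂ (~-sym (links-adjacent K₀ c₀~x c₁~x c₁~a c₂~a)))))
    ...   | no c₂≁x | no c₀≁x
      with any? (λ m → (c₁ ~? m) ×-dec (c₂ ~? m) ×-dec ¬? (x ~? m))
    ...     | no uncovered = inj₁ record
              { vertex = x ; dominating = x∈D ; adjacent = c₁~x ; not-adjacent = c₂≁x
              ; covers = λ {m} c₁~m c₂~m → decidable-stable (x ~? m)
                           (λ x≁m → uncovered (m , c₁~m , c₂~m , x≁m)) }
    ...     | yes (m , c₁~m , c₂~m , x≁m) = inj₂ (inj₂ (inj₂ record
              { vertex = x ; dominating = x∈D ; adjacent = c₁~x ; not-adjacent = c₀≁x
              ; covers = λ c₁~a c₀~a → pendant-adjacent netFree (Corner-reverse K₀) c₁~x c₂~m c₁~m c₁~a c₀~a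
                  (∉N[]-via c₁~x (c₂∉N[c₁] K₀) c₂≁x) (∉N[]-via c₁~x (∉N[]-sym (c₁∉N[c₀] K₀)) c₀≁x)
                  [ (λ x≡m → c₂≁x (subst (c₂ ~_) (≡-sym x≡m) c₂~m)) , (λ m~x → x≁m (~-sym m~x)) ]′ }))

    record LinkDominators (k : ℕ) (g : ℕ → Fin n) : Set where
      field
        y : ℕ → Fin n
        y∈D : ∀ j → y j ∈ D
        y-covers : ∀ j {m} → g j ~ m → g (suc j) ~ m → y j ~ m
        y-distinct : ∀ {i j} → i < j → j ≤ 3 + k → y i ≢ y j

    module _ {k : ℕ} {g : ℕ → Fin n} (C : SquareCycle k g) where
      open SquareCycle C

      forward-dominators : Guard (g 0) (g 1) → LinkDominators k g
      forward-dominators γ₀ = record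
        { y = λ j → vertex (γ j) ; y∈D = λ j → dominating (γ j) ; y-covers = λ j → covers (γ j)
        ; y-distinct = distinct }
        where
        γ : ∀ j → Guard (g j) (g (suc j))
        γ zero = γ₀
        γ (suc j) = guard-step (corner chordal C j) (γ j)
        distinct : ∀ {i j} → i < j → j ≤ 3 + k → vertex (γ i) ≢ vertex (γ j)
        distinct {i} i<j j≤ yi≡yj with gap-cases i<j j≤
        ... | inj₁ refl = not-adjacent (γ i) (subst (g (suc i) ~_) (≡-sym yi≡yj) (adjacent (γ (suc i))))
        ... | inj₂ (inj₁ (d , refl , 2≤d , d≤)) =
          far i 2≤d d≤ (inj₂ (adjacent (γ i))) (inj₂ (subst (g (i + d) ~_) (≡-sym yi≡yj) (adjacent (γ (i + d)))))
        ... | inj₂ (inj₂ (refl , refl)) =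
          not-adjacent (γ (3 + k)) (subst₂ _~_ (≡-sym (periodic 0)) yi≡yj (adjacent (γ 0)))

      backward-dominators : Guard (g 1) (g 0) → LinkDominators k g
      backward-dominators γ₁ = record
        { y = λ j → vertex (γ j) ; y∈D = λ j → dominating (γ j)
        ; y-covers = λ j gj~m gsj~m → covers (γ j) gsj~m gj~m ; y-distinct = distinct }
        where
        -- Guards only propagate backwards, so the one at j is reached from a multiple of the period.
        descend : ∀ N {j} → j ≤ N → Guard (g (suc N)) (g N) → Guard (g (suc j)) (g j)
        descend zero z≤n γN = γN
        descend (suc N) {j} j≤ γN with m≤n⇒m<n∨m≡n j≤
        ... | inj₁ j<sN = descend N (≤-pred j<sN) (guard-stepᵣ (corner chordal C N) γN)
        ... | inj₂ refl = γN
        at-multiple : ∀ t → Guard (g (suc (t * (4 + k)))) (g (t * (4 + k)))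
        at-multiple zero = γ₁
        at-multiple (suc t) rewrite +-comm (4 + k) (t * (4 + k)) =
          subst₂ Guard (≡-sym (periodic (suc (t * (4 + k))))) (≡-sym (periodic (t * (4 + k)))) (at-multiple t)
        γ : ∀ j → Guard (g (suc j)) (g j)
        γ j = descend (j * (4 + k)) (m≤m*n j (4 + k)) (at-multiple j)
        distinct : ∀ {i j} → i < j → j ≤ 3 + k → vertex (γ i) ≢ vertex (γ j)
        distinct {i} i<j j≤ yi≡yj with gap-cases i<j j≤
        ... | inj₁ refl = not-adjacent (γ (suc i)) (subst (g (suc i) ~_) yi≡yj (adjacent (γ i)))
        ... | inj₂ (inj₁ (d , refl , 2≤d , d≤)) =
          far (suc i) 2≤d d≤ (inj₂ (adjacent (γ i))) (inj₂ (subst (g (suc (i + d)) ~_) (≡-sym yi≡yj) (adjacent (γ (i + d)))))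
        ... | inj₂ (inj₂ (refl , refl)) =
          not-adjacent (γ 0) (subst₂ _~_ (periodic 0) (≡-sym yi≡yj) (adjacent (γ (3 + k))))

      mid : ℕ → Fin n
      mid j = proj₁ (common-neighbour chordal C j)

      g~mid : ∀ j → g j ~ mid j
      g~mid j = proj₁ (proj₂ (common-neighbour chordal C j))

      gsuc~mid : ∀ j → g (suc j) ~ mid j
      gsuc~mid j = proj₂ (proj₂ (common-neighbour chordal C j))

      mid-adjacent : ∀ j → mid j ~ mid (suc j)
      mid-adjacent j = links-adjacent (corner chordal C j) (g~mid j) (gsuc~mid j) (g~mid (suc j)) (gsuc~mid (suc j))

      mid-wrap : mid 0 ~ mid (3 + k)
      mid-wrap = ~-sym (links-adjacent (corner chordal C (3 + k)) (g~mid (3 + k)) (gsuc~mid (3 + k))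
        (subst (_~ mid 0) (≡-sym (periodic 0)) (g~mid 0)) (subst (_~ mid 0) (≡-sym (periodic 1)) (gsuc~mid 0)))

      mid-distinct : ∀ {i j} → i < j → j ≤ 3 + k → mid i ≢ mid j
      mid-distinct {i} i<j j≤ mi≡mj with gap-cases i<j j≤
      ... | inj₁ refl =
        far₀₂ (corner chordal C i) (inj₂ (g~mid i)) (inj₂ (subst (g (2 + i) ~_) (≡-sym mi≡mj) (gsuc~mid (suc i))))
      ... | inj₂ (inj₁ (d , refl , 2≤d , d≤)) =
        far i 2≤d d≤ (inj₂ (g~mid i)) (inj₂ (subst (g (i + d) ~_) (≡-sym mi≡mj) (g~mid (i + d))))
      ... | inj₂ (inj₂ (refl , refl)) =
        far 1 (s≤s (s≤s z≤n)) ≤-refl (inj₂ (gsuc~mid 0)) (inj₂ (subst (g (3 + k) ~_) (≡-sym mi≡mj) (g~mid (3 + k))))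

      mid-walk : ∀ {t₀} → 2 + t₀ ≤ 3 + k → (∀ {t} → t < t₀ → ¬ mid 0 ~ mid (2 + t)) →
                 AvoidingWalk (mid 0) (mid 1) (mid (2 + t₀)) (1 + t₀) (λ t → mid (suc t))
      mid-walk {t₀} j≤ unchorded = record
        { start = refl ; end = refl ; step = λ {i} _ → inj₂ (mid-adjacent (suc i)) ; interior = interior′ }
        where
        interior′ : ∀ {t} → 0 < t → t < 1 + t₀ → Avoids (mid 0) (mid 1) (mid (2 + t₀)) (mid (suc t))
        interior′ {suc t} _ t< = inj₂ (inj₂ [ (λ e → mid-distinct (s≤s z≤n) bound (≡-sym e)) , unchorded (≤-pred t<) ]′)
          where
          bound : 2 + t ≤ 3 + k
          bound = ≤-trans (s≤s (s≤s (<⇒≤ (≤-pred t<)))) j≤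

      module _ (S : LinkDominators k g) where
        open LinkDominators S

        y~mid : ∀ j → y j ~ mid j
        y~mid j = y-covers j (g~mid j) (gsuc~mid j)

        y∉N[mid] : ∀ i j → i ≤ 3 + k → j ≤ 3 + k → i ≢ j → y i ∉N[ mid j ]
        y∉N[mid] i j i≤ j≤ i≢j yi∈N = pairwise-≢ y-distinct i≤ j≤ i≢j
          (dominator-unique (y∈D i) (y∈D j) yi∈N (inj₂ (~-sym (y~mid j))))

        y∉N[y] : ∀ i j → i ≤ 3 + k → j ≤ 3 + k → i ≢ j → y j ∉N[ y i ]
        y∉N[y] i j i≤ j≤ i≢j yj∈N = pairwise-≢ y-distinct i≤ j≤ i≢j
          (dominator-unique (y∈D i) (y∈D j) (inj₁ refl) yj∈N)

        -- Take the first mid j, j ≥ 2, adjacent to mid 0. If mid 1 ~ mid j, the triangle mid 0, mid 1, mid j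
        -- with pendants y 0, y 1, y j is an induced net; otherwise mid 1, …, mid j is a walk around mid 0.
        ¬linkDominators : ⊥
        ¬linkDominators with minimal (λ t → mid 0 ~? mid (2 + t)) (1 + k) mid-wrap
        ... | t₀ , t₀≤ , mid0~midj , unchorded with mid 1 ~? mid (2 + t₀)
        ...   | yes mid1~midj = netFree⇒¬Net netFree record
                  { a~b = mid-adjacent 0 ; b~c = mid1~midj ; a~c = mid0~midj
                  ; a~a′ = ~-sym (y~mid 0) ; b~b′ = ~-sym (y~mid 1) ; c~c′ = ~-sym (y~mid j)
                  ; b′∉N[a] = y∉N[mid] 1 0 b₁ b₀ (λ ()) ; c′∉N[a] = y∉N[mid] j 0 bⱼ b₀ (λ ())
                  ; a′∉N[b] = y∉N[mid] 0 1 b₀ b₁ (λ ()) ; c′∉N[b] = y∉N[mid] j 1 bⱼ b₁ (λ ())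
                  ; a′∉N[c] = y∉N[mid] 0 j b₀ bⱼ (λ ()) ; b′∉N[c] = y∉N[mid] 1 j b₁ bⱼ (λ ())
                  ; b′∉N[a′] = y∉N[y] 0 1 b₀ b₁ (λ ()) ; c′∉N[a′] = y∉N[y] 0 j b₀ bⱼ (λ ())
                  ; c′∉N[b′] = y∉N[y] 1 j b₁ bⱼ (λ ()) }
          where
          j : ℕ
          j = 2 + t₀
          b₀ : 0 ≤ 3 + k
          b₀ = z≤n
          b₁ : 1 ≤ 3 + k
          b₁ = s≤s z≤n
          bⱼ : j ≤ 3 + k
          bⱼ = s≤s (s≤s t₀≤)
        ...   | no mid1≁midj
          with avoidingWalk⇒∈N[] chordal (mid-adjacent 0) mid0~midj (mid-walk (s≤s (s≤s t₀≤)) unchorded)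
        ...     | inj₁ midj≡mid1 = mid-distinct (s≤s (s≤s z≤n)) (s≤s (s≤s t₀≤)) (≡-sym midj≡mid1)
        ...     | inj₂ mid1~midj = mid1≁midj mid1~midj

    ¬squareCycle : ∀ {k g} → SquareCycle k g → ⊥
    ¬squareCycle C with guard-nearby (corner chordal C 0) (corner chordal C 1) (corner chordal C 2)
    ... | inj₁ γ = ¬linkDominators (shift C 1) (forward-dominators (shift C 1) γ)
    ... | inj₂ (inj₁ γ) = ¬linkDominators (shift C 2) (forward-dominators (shift C 2) γ)
    ... | inj₂ (inj₂ (inj₁ γ)) = ¬linkDominators (shift C 3) (forward-dominators (shift C 3) γ)
    ... | inj₂ (inj₂ (inj₂ γ)) = ¬linkDominators C (backward-dominators C γ)

lemma1 : {n : ℕ} (G : Graph n) → Chordal (Adj G) → NetFree (Adj G) →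
    HasEDS G → Chordal (SquareAdj G)
lemma1 G chordal netFree (D , eds) _ (s≤s (s≤s (s≤s (s≤s (z≤n {k}))))) hole =
  ¬squareCycle G chordal netFree eds (proj₂ (squareCycle G hole))
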